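{- Let $n\ge1$ and $d\ge2$ with $n$ or $d$ odd. Let $s_2,\dots,s_d\in\{1,\dots,n-1\}$ with $\gcd(s_i,n)=1$ for all $i$, and let $\pi^2_n,\dots,\pi^d_n\in\{0,\dots,n-1\}$. For $2\le i\le d$ and $1\le j\le n$ let $\pi^i_j\in\{0,\dots,n-1\}$ be defined by $\pi^i_j\equiv\pi^i_n+j\,s_i \pmod n$. Then $\Pi=(\pi^2,\dots,\pi^d)$, with $\pi^i=\pi^i_1\cdots\pi^i_n$, belongs to $S^d_n$. Moreover, let $d=4$ and $n=2k+1$ with $k\ge1$, and suppose $s_2=1$ and $\pi^2_n=n-1$. Then: (a) if $s_3=1$, then $\Pi\in M_{4,n}$ if and only if $s_4=n-2$ and $(\pi^3_n,\pi^4_n)\in\{(k-1,1),(k,0)\}$; (b) if $s_3=k$, then $\Pi\in M_{4,n}$ if and only if $s_4=k$ and $(\pi^3_n,\pi^4_n)\in\{(0,k),(k,0)\}$.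
   Context: $S_n$ is the set of permutations of $\{0,\dots,n-1\}$ in one-line notation. $S^d_n$ is the set of $(d-1)$-tuples $\Pi=(\pi^2,\dots,\pi^d)$ of elements of $S_n$, with elements (columns) $\Pi_j=(\pi^2_j,\dots,\pi^d_j)^T$. The (sum) level is $\mathrm{lev}(\Pi_j)=\pi^2_j+\dots+\pi^d_j$ and $\mathrm{lev}_{\max}(\Pi)=\max_j\mathrm{lev}(\Pi_j)$. Let $m_{d,n}=\min\{\mathrm{lev}_{\max}(\Pi):\Pi\in S^d_n\}$ and $M_{d,n}=\{\Pi\in S^d_n:\mathrm{lev}_{\max}(\Pi)=m_{d,n}\}$ (minimal permutations). -}

module Defs where

open import Data.Nat using (ℕ; zero; suc; _+_; _*_; _∸_; _≤_; _⊔_; NonZero)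
open import Data.Nat.DivMod using (_mod_)
open import Data.Fin using (Fin; toℕ)
open import Data.List using (List; map; foldr; allFin)
open import Data.Nat.ListAction using (sum)
open import Data.Product using (_×_)
open import Function.Definitions using (Bijective)
open import Relation.Binary.PropositionalEquality using (_≡_)

-- An element of S_n in one-line notation: a function from positions
-- (Fin n, position p ↔ index j = p+1) to values {0,…,n-1} = Fin n,
-- which is a permutation, i.e. bijective.
IsPerm : (n : ℕ) → (Fin n → Fin n) → Set
IsPerm n π = Bijective _≡_ _≡_ π

-- A (d-1)-tuple (π², …, π^d); row index r : Fin (d ∸ 1) stands for i = r + 2.
Tuple : (d n : ℕ) → Set
Tuple d n = Fin (d ∸ 1) → Fin n → Fin n

InS : (d n : ℕ) → Tuple d n → Set
InS d n Π = ∀ r → IsPerm n (Π r)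

lev : (d n : ℕ) → Tuple d n → Fin n → ℕ
lev d n Π p = sum (map (λ r → toℕ (Π r p)) (allFin (d ∸ 1)))

levMax : (d n : ℕ) → Tuple d n → ℕ
levMax d n Π = foldr _⊔_ 0 (map (lev d n Π) (allFin n))

-- Π ∈ M_{d,n}: Π ∈ S^d_n and lev_max(Π) = m_{d,n}, i.e. lev_max(Π) is
-- at most lev_max of every element of S^d_n.
InM : (d n : ℕ) → Tuple d n → Set
InM d n Π = InS d n Π × (∀ Π′ → InS d n Π′ → levMax d n Π ≤ levMax d n Π′)

gen : (d n : ℕ) .{{_ : NonZero n}} → (s : Fin (d ∸ 1) → ℕ) → (base : Fin (d ∸ 1) → Fin n) → Tuple d n
gen d n s base r p = (toℕ (base r) + suc (toℕ p) * s r) mod n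

-- A row p ↦ b + (p+1)s mod n is injective when gcd(s, n) = 1, since two equal values
-- at p ≤ q force n ∣ (q - p)s, hence n ∣ q - p < n; an injective endomap of Fin n is a permutation.
-- For d = 4 and n = 2k+1 every Π ∈ S⁴ₙ has total level 3(0 + ⋯ + 2k) = 3kn, so lev_max Π ≥ 3k,
-- and the affine tuple with steps (1, k, k) and bases (2k, k, 0) has all its columns at level 3k.
-- Hence Π ∈ M₄,ₙ iff every column of Π has level 3k. The first row being the identity, this is an
-- arithmetic condition on the bases b₁ = π³ₙ, b₂ = π⁴ₙ and step s₂ = s₄ of the other two rows:
-- the last column gives b₁ + b₂ = k, the first column then determines s₂, and in case (b) the
-- second column excludes b₁, b₂ > 0. Conversely the listed parameters are checked column by
-- column, splitting the columns at k in case (a) and by parity in case (b).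

module Submission where

open import Defs
open import Data.Nat using (ℕ; zero; suc; _+_; _*_; _∸_; _≤_; _%_; NonZero)
open import Data.Nat.GCD using (gcd)
open import Data.Fin using (Fin; toℕ; zero; suc)
open import Data.Product using (_×_)
open import Data.Sum using (_⊎_)
open import Function.Bundles using (_⇔_)
open import Relation.Binary.PropositionalEquality using (_≡_)

open import Data.Nat using (_<_; _⊔_; z≤n; s≤s; s≤s⁻¹; z<s)
open import Data.Nat.Properties
open import Data.Nat.DivMod using (_mod_; _/_; m≡m%n+[m/n]*n; m%n<n; [m+kn]%n≡m%n; [m+n]%n≡m%n; m<n⇒m%n≡m)
open import Data.Nat.Divisibility using (_∣_; divides; ∣m+n∣m⇒∣n; n∣m*n; ∣⇒≤)
open import Data.Nat.Coprimality using (Coprime; coprime-divisor; coprime-+; 1-coprimeTo; gcd≡1⇒coprime)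
import Data.Nat.Coprimality as Coprime
open import Data.Nat.ListAction using (sum)
open import Data.Nat.Tactic.RingSolver using (solve; solve-∀)
open import Data.Fin using (fromℕ; fromℕ<)
open import Data.Fin.Properties using (toℕ-fromℕ; toℕ-fromℕ<; toℕ-injective; toℕ<n; any?; punchOut-injective; <⇒notInjective)
import Data.Fin.Properties as Fin
open import Data.List using (List; []; _∷_; map; allFin; tabulate; length)
open import Data.List.Properties using (map-tabulate; length-map; length-tabulate; foldr-forcesᵇ; foldr-preservesᵇ)
open import Data.List.Relation.Unary.All using (All)
import Data.List.Relation.Unary.All.Properties as All
open import Data.Product using (_,_; proj₂; ∃; ∃₂; map₂)
open import Data.Sum using (inj₁; inj₂)
open import Function.Base using (_∘_)
open import Function.Bundles using (mk⇔; mk⤖; Equivalence)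
import Function.Properties.Equivalence as ⇔
open import Function.Definitions using (Injective; Surjective)
open import Function.Properties.Bijection using (⤖⇒↔)
open import Relation.Nullary using (yes; no; contradiction)
open import Relation.Binary using (tri<; tri≈; tri>)
open import Relation.Binary.PropositionalEquality using (refl; sym; trans; cong; cong₂; subst; _≢_; module ≡-Reasoning)
import Algebra.Properties.CommutativeMonoid.Sum as Sum

open Sum +-0-commutativeMonoid using (∑-comm; ∑-permute; sum-cong-≗) renaming (sum to ∑)

-- Affine rows are permutations

[m+n]%d≡m%d⇒d∣n : ∀ m n d .{{_ : NonZero d}} → (m + n) % d ≡ m % d → d ∣ n
[m+n]%d≡m%d⇒d∣n m n d eq = ∣m+n∣m⇒∣n (divides ((m + n) / d) quotients) (n∣m*n (m / d))
  where
  open ≡-Reasoning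
  quotients : (m / d) * d + n ≡ ((m + n) / d) * d
  quotients = +-cancelˡ-≡ (m % d) _ _ (begin
    m % d + ((m / d) * d + n)        ≡⟨ sym (+-assoc (m % d) _ n) ⟩
    m % d + (m / d) * d + n          ≡⟨ cong (_+ n) (sym (m≡m%n+[m/n]*n m d)) ⟩
    m + n                            ≡⟨ m≡m%n+[m/n]*n (m + n) d ⟩
    (m + n) % d + ((m + n) / d) * d  ≡⟨ cong (_+ ((m + n) / d) * d) eq ⟩
    m % d + ((m + n) / d) * d        ∎)

injective⇒surjective : ∀ {n} {f : Fin n → Fin n} → Injective _≡_ _≡_ f → Surjective _≡_ _≡_ f
injective⇒surjective {zero} _ ()
injective⇒surjective {suc n} {f} inj y with any? (λ x → f x Fin.≟ y)
... | yes (x , fx≡y) = x , λ { refl → fx≡y }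
... | no y∉im = contradiction (λ {x} {x′} → inj ∘ punchOut-injective (y≢f x) (y≢f x′)) (<⇒notInjective (n<1+n n))
  where
  y≢f : ∀ x → y ≢ f x
  y≢f x y≡fx = y∉im (x , sym y≡fx)

row : (n : ℕ) .{{_ : NonZero n}} → ℕ → ℕ → ℕ → ℕ
row n b s P = (b + suc P * s) % n

toℕ-mod : ∀ m n .{{_ : NonZero n}} → toℕ (m mod n) ≡ m % n
toℕ-mod m n = toℕ-fromℕ< (m%n<n m n)

toℕ-gen : ∀ d n .{{_ : NonZero n}} s base r p → toℕ (gen d n s base r p) ≡ row n (toℕ (base r)) (s r) (toℕ p)
toℕ-gen d n s base r p = toℕ-mod _ n

n∣m<n⇒m≡0 : ∀ {m n} → n ∣ m → m < n → m ≡ 0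
n∣m<n⇒m≡0 {zero}  _   _   = refl
n∣m<n⇒m≡0 {suc m} n∣m m<n = contradiction (∣⇒≤ n∣m) (<⇒≱ m<n)

row-injective : ∀ {n} .{{_ : NonZero n}} {b s} → Coprime n s →
                ∀ {P Q} → P ≤ Q → Q < n → row n b s P ≡ row n b s Q → P ≡ Q
row-injective {n} {b = b} {s} n⊥s {P} P≤Q Q<n eq with m≤n⇒∃[o]m+o≡n P≤Q
... | D , refl = sym (trans (cong (P +_) D≡0) (+-identityʳ P))
  where
  shifted : row n b s (P + D) ≡ (b + suc P * s + D * s) % n
  shifted = cong (_% n) (solve (b ∷ s ∷ P ∷ D ∷ []))
  D≡0 : D ≡ 0
  D≡0 = n∣m<n⇒m≡0
    (coprime-divisor n⊥s (subst (n ∣_) (*-comm D s)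
      ([m+n]%d≡m%d⇒d∣n (b + suc P * s) (D * s) n (trans (sym shifted) (sym eq)))))
    (≤-<-trans (m≤n+m D P) Q<n)

affine-isPerm : ∀ n .{{_ : NonZero n}} b s → Coprime n s → IsPerm n (λ p → (b + suc (toℕ p) * s) mod n)
affine-isPerm n b s n⊥s = injective , injective⇒surjective injective
  where
  π : Fin n → Fin n
  π p = (b + suc (toℕ p) * s) mod n
  rows-equal : ∀ p q → π p ≡ π q → row n b s (toℕ p) ≡ row n b s (toℕ q)
  rows-equal _ _ eq = trans (sym (toℕ-mod _ n)) (trans (cong toℕ eq) (toℕ-mod _ n))
  injective : Injective _≡_ _≡_ π
  injective {p} {q} eq with ≤-total (toℕ p) (toℕ q)
  ... | inj₁ p≤q = toℕ-injective (row-injective {b = b} n⊥s p≤q (toℕ<n q) (rows-equal p q eq))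
  ... | inj₂ q≤p = toℕ-injective (sym (row-injective {b = b} n⊥s q≤p (toℕ<n p) (rows-equal q p (sym eq))))

gen∈S : ∀ d n .{{_ : NonZero n}} s base → (∀ r → Coprime n (s r)) → InS d n (gen d n s base)
gen∈S d n s base n⊥s r = affine-isPerm n (toℕ (base r)) (s r) (n⊥s r)

-- Column levels and minimality

sum-tabulate : ∀ {n} (f : Fin n → ℕ) → sum (tabulate f) ≡ ∑ f
sum-tabulate {zero}  f = refl
sum-tabulate {suc n} f = cong (f zero +_) (sum-tabulate (f ∘ suc))

sum-map-allFin : ∀ {n} (f : Fin n → ℕ) → sum (map f (allFin n)) ≡ ∑ f
sum-map-allFin f = trans (cong sum (map-tabulate (λ i → i) f)) (sum-tabulate f)

sum-≤ : ∀ {B} {xs : List ℕ} → All (_≤ B) xs → sum xs ≤ length xs * B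
sum-≤ All.[]           = z≤n
sum-≤ (x≤B All.∷ xs≤B) = +-mono-≤ x≤B (sum-≤ xs≤B)

sum-≡ : ∀ {B} {xs : List ℕ} → All (_≡ B) xs → sum xs ≡ length xs * B
sum-≡ All.[]             = refl
sum-≡ (refl All.∷ xs≡B) = cong (_ +_) (sum-≡ xs≡B)

sum≡⇒All≡ : ∀ {B} {xs : List ℕ} → All (_≤ B) xs → sum xs ≡ length xs * B → All (_≡ B) xs
sum≡⇒All≡         All.[]           _  = All.[]
sum≡⇒All≡ {B} (x≤B All.∷ xs≤B) eq with m≤n⇒m<n∨m≡n x≤B
... | inj₁ x<B  = contradiction eq (<⇒≢ (+-mono-<-≤ x<B (sum-≤ xs≤B)))
... | inj₂ refl = refl All.∷ sum≡⇒All≡ xs≤B (+-cancelˡ-≡ B _ _ eq)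

levels : ∀ d n → Tuple d n → List ℕ
levels d n Π = map (lev d n Π) (allFin n)

length-levels : ∀ d n (Π : Tuple d n) → length (levels d n Π) ≡ n
length-levels d n Π = trans (length-map (lev d n Π) (allFin n)) (length-tabulate (λ i → i))

All-levels⁺ : ∀ d n (Π : Tuple d n) {P : ℕ → Set} → (∀ p → P (lev d n Π p)) → All P (levels d n Π)
All-levels⁺ d n Π h = All.map⁺ (All.tabulate⁺ h)

All-levels⁻ : ∀ d n (Π : Tuple d n) {P : ℕ → Set} → All P (levels d n Π) → ∀ p → P (lev d n Π p)
All-levels⁻ d n Π h = All.tabulate⁻ (All.map⁻ h)

lev≤levMax : ∀ d n (Π : Tuple d n) p → lev d n Π p ≤ levMax d n Π
lev≤levMax d n Π = All-levels⁻ d n Π (foldr-forcesᵇ {P = _≤ levMax d n Π} {f = _⊔_} split 0 _ ≤-refl)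
  where
  split : ∀ {m} x y → x ⊔ y ≤ m → x ≤ m × y ≤ m
  split x y x⊔y≤m = m⊔n≤o⇒m≤o x y x⊔y≤m , m⊔n≤o⇒n≤o x y x⊔y≤m

levMax≤ : ∀ d n (Π : Tuple d n) {B} → (∀ p → lev d n Π p ≤ B) → levMax d n Π ≤ B
levMax≤ d n Π {B} h = foldr-preservesᵇ {P = _≤ B} ⊔-lub z≤n (All-levels⁺ d n Π h)

sum-levels : ∀ d n (Π : Tuple d n) → InS d n Π → sum (levels d n Π) ≡ ∑ {d ∸ 1} (λ _ → ∑ {n} toℕ)
sum-levels d n Π Π∈S = begin
  sum (levels d n Π)                       ≡⟨ sum-map-allFin (lev d n Π) ⟩
  ∑ {n} (λ p → lev d n Π p)                ≡⟨ sum-cong-≗ (λ p → sum-map-allFin (λ r → toℕ (Π r p))) ⟩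
  ∑ {n} (λ p → ∑ {d ∸ 1} (λ r → toℕ (Π r p)))  ≡⟨ ∑-comm (λ p r → toℕ (Π r p)) ⟩
  ∑ {d ∸ 1} (λ r → ∑ {n} (λ p → toℕ (Π r p)))  ≡⟨ sum-cong-≗ (λ r → sym (∑-permute toℕ (⤖⇒↔ (mk⤖ (Π∈S r))))) ⟩
  ∑ {d ∸ 1} (λ _ → ∑ {n} toℕ)              ∎
  where open ≡-Reasoning

Flat : ∀ d n → Tuple d n → ℕ → Set
Flat d n Π B = ∀ p → lev d n Π p ≡ B

module _ {d n : ℕ} .{{_ : NonZero n}} {Π₀ : Tuple d n} {B : ℕ} (Π₀∈S : InS d n Π₀) (flat₀ : Flat d n Π₀ B) where

  sum-levels≡n*B : ∀ Π → InS d n Π → sum (levels d n Π) ≡ n * B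
  sum-levels≡n*B Π Π∈S = begin
    sum (levels d n Π)              ≡⟨ sum-levels d n Π Π∈S ⟩
    ∑ {d ∸ 1} (λ _ → ∑ {n} toℕ)     ≡⟨ sum-levels d n Π₀ Π₀∈S ⟨
    sum (levels d n Π₀)             ≡⟨ sum-≡ (All-levels⁺ d n Π₀ flat₀) ⟩
    length (levels d n Π₀) * B      ≡⟨ cong (_* B) (length-levels d n Π₀) ⟩
    n * B                           ∎
    where open ≡-Reasoning

  B≤levMax : ∀ Π → InS d n Π → B ≤ levMax d n Π
  B≤levMax Π Π∈S = *-cancelˡ-≤ n (begin
    n * B                                    ≡⟨ sum-levels≡n*B Π Π∈S ⟨
    sum (levels d n Π)                       ≤⟨ sum-≤ (All-levels⁺ d n Π (lev≤levMax d n Π)) ⟩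
    length (levels d n Π) * levMax d n Π     ≡⟨ cong (_* levMax d n Π) (length-levels d n Π) ⟩
    n * levMax d n Π                         ∎)
    where open ≤-Reasoning

  minimal⇔flat : ∀ Π → InS d n Π → InM d n Π ⇔ Flat d n Π B
  minimal⇔flat Π Π∈S = mk⇔ to from
    where
    to : InM d n Π → Flat d n Π B
    to (_ , minimal) = All-levels⁻ d n Π (sum≡⇒All≡ levels≤B
      (trans (sum-levels≡n*B Π Π∈S) (cong (_* B) (sym (length-levels d n Π)))))
      where
      levels≤B : All (_≤ B) (levels d n Π)
      levels≤B = All-levels⁺ d n Π (λ p → ≤-trans (lev≤levMax d n Π p)
        (≤-trans (minimal Π₀ Π₀∈S) (levMax≤ d n Π₀ (≤-reflexive ∘ flat₀))))
    from : Flat d n Π B → InM d n Π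
    from flat = Π∈S , λ Π′ Π′∈S → ≤-trans (levMax≤ d n Π (≤-reflexive ∘ flat)) (B≤levMax Π′ Π′∈S)

-- Residues modulo n

%-unique : ∀ n .{{_ : NonZero n}} {m} r q x → m ≡ r + q * n → n ≡ suc (r + x) → m % n ≡ r
%-unique n r q x refl refl = trans ([m+kn]%n≡m%n r q n) (m<n⇒m%n≡m (s≤s (m≤m+n r x)))

row≡ : ∀ k b s P r q x → b + suc P * s ≡ r + q * suc (k + k) → k + k ≡ r + x → row (suc (k + k)) b s P ≡ r
row≡ k b s P r q x m≡ k+k≡ = %-unique (suc (k + k)) r q x m≡ (cong suc k+k≡)

m<n+n⇒m%n≡m⊎m%n+n≡m : ∀ n .{{_ : NonZero n}} m → m < n + n → m % n ≡ m ⊎ m % n + n ≡ m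
m<n+n⇒m%n≡m⊎m%n+n≡m n m m<n+n with m <? n
... | yes m<n = inj₁ (m<n⇒m%n≡m m<n)
... | no  m≮n with m≤n⇒∃[o]m+o≡n (≮⇒≥ m≮n)
...   | c , refl = inj₂ (trans (cong (_+ n) c%n≡c) (+-comm c n))
  where
  c%n≡c : (n + c) % n ≡ c
  c%n≡c = trans (cong (_% n) (+-comm n c))
            (trans ([m+n]%n≡m%n c n) (m<n⇒m%n≡m (+-cancelˡ-< n c n m<n+n)))

row-identity : ∀ m P → P < suc m → row (suc m) m 1 P ≡ P
row-identity m P P<n = trans (cong (_% suc m) shift) (trans ([m+kn]%n≡m%n P 1 (suc m)) (m<n⇒m%n≡m P<n))
  where
  shift : m + suc P * 1 ≡ P + 1 * suc m
  shift = solve (m ∷ P ∷ [])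

row-last : ∀ m b s → b < suc m → row (suc m) b s m ≡ b
row-last m b s b<n =
  trans (cong (λ z → (b + z) % suc m) (*-comm (suc m) s)) (trans ([m+kn]%n≡m%n b s (suc m)) (m<n⇒m%n≡m b<n))

row-0≡⇒step≡ : ∀ n .{{_ : NonZero n}} {b s c} → b < n → s < n → row n b s 0 ≡ b + c → s ≡ c
row-0≡⇒step≡ n {b} {s} {c} b<n s<n eq with m<n+n⇒m%n≡m⊎m%n+n≡m n (b + 1 * s) (+-mono-< b<n (subst (_< n) (sym (*-identityˡ s)) s<n))
... | inj₁ ≡m = trans (sym (*-identityˡ s)) (+-cancelˡ-≡ b _ _ (trans (sym ≡m) eq))
... | inj₂ +n≡m = contradiction s<n (≤⇒≯ (begin
  n           ≤⟨ m≤n+m n c ⟩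
  c + n       ≡⟨ +-cancelˡ-≡ b _ _ (trans (sym (+-assoc b c n)) (trans (cong (_+ n) (sym eq)) +n≡m)) ⟩
  1 * s       ≡⟨ *-identityˡ s ⟩
  s           ∎))
  where open ≤-Reasoning

-- The case d = 4, n = 2k + 1

Balanced : (k b₁ s₁ b₂ s₂ : ℕ) → Set
Balanced k b₁ s₁ b₂ s₂ =
  ∀ P → P < suc (k + k) → P + row (suc (k + k)) b₁ s₁ P + row (suc (k + k)) b₂ s₂ P ≡ k + k + k

balanced-swap : ∀ {k b₁ s₁ b₂ s₂} → Balanced k b₁ s₁ b₂ s₂ → Balanced k b₂ s₂ b₁ s₁
balanced-swap bal P P<n = trans (swap P _ _) (bal P P<n)
  where
  swap : ∀ a b c → a + b + c ≡ a + c + b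
  swap = solve-∀

balanced⇒b₁+b₂≡k : ∀ {k b₁ s₁ b₂ s₂} → b₁ < suc (k + k) → b₂ < suc (k + k) →
                    Balanced k b₁ s₁ b₂ s₂ → b₁ + b₂ ≡ k
balanced⇒b₁+b₂≡k {k} {b₁} {s₁} {b₂} {s₂} b₁<n b₂<n bal = +-cancelˡ-≡ (k + k) _ _ (begin
  k + k + (b₁ + b₂)  ≡⟨ sym (+-assoc (k + k) b₁ b₂) ⟩
  k + k + b₁ + b₂    ≡⟨ cong₂ (λ x y → k + k + x + y) (row-last (k + k) b₁ s₁ b₁<n) (row-last (k + k) b₂ s₂ b₂<n) ⟨
  k + k + row n b₁ s₁ (k + k) + row n b₂ s₂ (k + k)  ≡⟨ bal (k + k) (n<1+n (k + k)) ⟩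
  k + k + k          ∎)
  where
  n : ℕ
  n = suc (k + k)
  open ≡-Reasoning

module _ (k : ℕ) (s : Fin 3 → ℕ) (base : Fin 3 → Fin (suc (k + k)))
         (s₀≡1 : s zero ≡ 1) (b₀≡2k : toℕ (base zero) ≡ k + k) where

  private
    n b₁ b₂ s₁ s₂ : ℕ
    n = suc (k + k)
    b₁ = toℕ (base (suc zero))
    b₂ = toℕ (base (suc (suc zero)))
    s₁ = s (suc zero)
    s₂ = s (suc (suc zero))
    Π : Tuple 4 n
    Π = gen 4 n s base

  lev-gen₄ : ∀ p → lev 4 n Π p ≡ toℕ p + row n b₁ s₁ (toℕ p) + row n b₂ s₂ (toℕ p)
  lev-gen₄ p = begin
    toℕ (Π zero p) + (toℕ (Π (suc zero) p) + (toℕ (Π (suc (suc zero)) p) + 0))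
      ≡⟨ cong₂ _+_ first-row (cong₂ _+_ (toℕ-gen 4 n s base (suc zero) p) (cong (_+ 0) (toℕ-gen 4 n s base (suc (suc zero)) p))) ⟩
    toℕ p + (row n b₁ s₁ (toℕ p) + (row n b₂ s₂ (toℕ p) + 0))
      ≡⟨ reassociate (toℕ p) _ _ ⟩
    toℕ p + row n b₁ s₁ (toℕ p) + row n b₂ s₂ (toℕ p) ∎
    where
    open ≡-Reasoning
    reassociate : ∀ a b c → a + (b + (c + 0)) ≡ a + b + c
    reassociate = solve-∀
    first-row : toℕ (Π zero p) ≡ toℕ p
    first-row = begin
      toℕ (Π zero p)                             ≡⟨ toℕ-gen 4 n s base zero p ⟩
      row n (toℕ (base zero)) (s zero) (toℕ p)   ≡⟨ cong₂ (λ b s → row n b s (toℕ p)) b₀≡2k s₀≡1 ⟩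
      row n (k + k) 1 (toℕ p)                    ≡⟨ row-identity (k + k) (toℕ p) (toℕ<n p) ⟩
      toℕ p                                      ∎

  flat⇔balanced : Flat 4 n Π (k + k + k) ⇔ Balanced k b₁ s₁ b₂ s₂
  flat⇔balanced = mk⇔
    (λ flat P P<n → subst (λ P → P + row n b₁ s₁ P + row n b₂ s₂ P ≡ k + k + k) (toℕ-fromℕ< P<n)
                      (trans (sym (lev-gen₄ (fromℕ< P<n))) (flat (fromℕ< P<n))))
    (λ bal p → trans (lev-gen₄ p) (bal (toℕ p) (toℕ<n p)))

parity : ∀ P → (∃ λ t → P ≡ t + t) ⊎ (∃ λ t → P ≡ suc (t + t))
parity zero    = inj₁ (0 , refl)
parity (suc P) with parity P
... | inj₁ (t , refl) = inj₂ (t , refl)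
... | inj₂ (t , refl) = inj₁ (suc t , cong suc (sym (+-suc t t)))

parity-split : ∀ k P → P < suc (k + k) →
               (∃₂ λ t e → k ≡ t + e × P ≡ t + t) ⊎ (∃₂ λ t e → k ≡ suc (t + e) × P ≡ suc (t + t))
parity-split k P P<n with parity P
... | inj₁ (t , refl) with m≤n⇒∃[o]m+o≡n (≮⇒≥ λ k<t → <⇒≱ (+-mono-< k<t k<t) (s≤s⁻¹ P<n))
...   | e , t+e≡k = inj₁ (t , e , sym t+e≡k , refl)
parity-split k P P<n | inj₂ (t , refl) with m≤n⇒∃[o]m+o≡n (≰⇒> λ k≤t → <⇒≱ (s≤s⁻¹ P<n) (+-mono-≤ k≤t k≤t))
...   | e , t+e≡k = inj₂ (t , e , sym t+e≡k , refl)

trichotomy-around : ∀ k′ P → P < suc (suc k′ + suc k′) →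
  (∃ λ d → k′ ≡ P + d) ⊎ (P ≡ suc k′ ⊎ (∃₂ λ e f → k′ ≡ e + f × P ≡ suc (suc (k′ + e))))
trichotomy-around k′ P P<n with <-cmp P (suc k′)
... | tri< P<k _ _ = inj₁ (map₂ sym (m≤n⇒∃[o]m+o≡n (s≤s⁻¹ P<k)))
... | tri≈ _ P≡k _ = inj₂ (inj₁ P≡k)
... | tri> _ _ k<P with m≤n⇒∃[o]m+o≡n k<P
...   | e , refl with m≤n⇒∃[o]m+o≡n e≤k′
  where
  e≤k′ : e ≤ k′
  e≤k′ = s≤s⁻¹ (+-cancelˡ-≤ k′ (suc e) (suc k′)
           (subst (_≤ k′ + suc k′) (sym (+-suc k′ e)) (s≤s⁻¹ (s≤s⁻¹ P<n))))
...     | f , e+f≡k′ = inj₂ (inj₂ (e , f , sym e+f≡k′ , refl))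

balanced-k,k,0,k : ∀ k → Balanced k k k 0 k
balanced-k,k,0,k k P P<n with parity-split k P P<n
... | inj₁ (t , e , refl , refl) = trans
  (cong₂ (λ x y → P + x + y)
    (row≡ k k k P (t + 2 * e) t t (solve (t ∷ e ∷ [])) (solve (t ∷ e ∷ [])))
    (row≡ k 0 k P e t (2 * t + e) (solve (t ∷ e ∷ [])) (solve (t ∷ e ∷ []))))
  (solve (t ∷ e ∷ []))
... | inj₂ (t , e , refl , refl) = trans
  (cong₂ (λ x y → P + x + y)
    (row≡ k k k P e (t + 1) (2 * t + e + 2) (solve (t ∷ e ∷ [])) (solve (t ∷ e ∷ [])))
    (row≡ k 0 k P (t + 2 * e + 2) t t (solve (t ∷ e ∷ [])) (solve (t ∷ e ∷ []))))
  (solve (t ∷ e ∷ []))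

-- In case (a) we write k = k′ + 1, so that 2k - 1 = k′ + suc k′.
balanced-k∸1,1,1,2k∸1 : ∀ k′ → Balanced (suc k′) k′ 1 1 (k′ + suc k′)
balanced-k∸1,1,1,2k∸1 k′ P P<n with trichotomy-around k′ P P<n
... | inj₁ (d , refl) = trans
  (cong₂ (λ x y → P + x + y)
    (row≡ (suc k′) k′ 1 P (2 * P + d + 1) 0 (d + 1) (solve (P ∷ d ∷ [])) (solve (P ∷ d ∷ [])))
    (row≡ (suc k′) 1 (k′ + suc k′) P (2 * d + 2) P (2 * P) (solve (P ∷ d ∷ [])) (solve (P ∷ d ∷ []))))
  (solve (P ∷ d ∷ []))
... | inj₂ (inj₁ refl) = trans
  (cong₂ (λ x y → P + x + y)
    (row≡ (suc k′) k′ 1 P (2 * k′ + 2) 0 0 (solve (k′ ∷ [])) (solve (k′ ∷ [])))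
    (row≡ (suc k′) 1 (k′ + suc k′) P 0 (suc k′) (2 * k′ + 2) (solve (k′ ∷ [])) (solve (k′ ∷ []))))
  (solve (k′ ∷ []))
... | inj₂ (inj₂ (e , f , refl , refl)) = trans
  (cong₂ (λ x y → P + x + y)
    (row≡ (suc k′) k′ 1 P e 1 (e + 2 * f + 2) (solve (e ∷ f ∷ [])) (solve (e ∷ f ∷ [])))
    (row≡ (suc k′) 1 (k′ + suc k′) P (2 * f + 1) (2 * e + f + 1) (2 * e + 1) (solve (e ∷ f ∷ [])) (solve (e ∷ f ∷ []))))
  (solve (e ∷ f ∷ []))

balanced-k,1,0,2k∸1 : ∀ k′ → Balanced (suc k′) (suc k′) 1 0 (k′ + suc k′)
balanced-k,1,0,2k∸1 k′ P P<n with trichotomy-around k′ P P<n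
... | inj₁ (d , refl) = trans
  (cong₂ (λ x y → P + x + y)
    (row≡ (suc k′) (suc k′) 1 P (2 * P + d + 2) 0 d (solve (P ∷ d ∷ [])) (solve (P ∷ d ∷ [])))
    (row≡ (suc k′) 0 (k′ + suc k′) P (2 * d + 1) P (2 * P + 1) (solve (P ∷ d ∷ [])) (solve (P ∷ d ∷ []))))
  (solve (P ∷ d ∷ []))
... | inj₂ (inj₁ refl) = trans
  (cong₂ (λ x y → P + x + y)
    (row≡ (suc k′) (suc k′) 1 P 0 1 (2 * k′ + 2) (solve (k′ ∷ [])) (solve (k′ ∷ [])))
    (row≡ (suc k′) 0 (k′ + suc k′) P (2 * k′ + 2) k′ 0 (solve (k′ ∷ [])) (solve (k′ ∷ []))))
  (solve (k′ ∷ []))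
... | inj₂ (inj₂ (e , f , refl , refl)) = trans
  (cong₂ (λ x y → P + x + y)
    (row≡ (suc k′) (suc k′) 1 P (e + 1) 1 (e + 2 * f + 1) (solve (e ∷ f ∷ [])) (solve (e ∷ f ∷ [])))
    (row≡ (suc k′) 0 (k′ + suc k′) P (2 * f) (2 * e + f + 1) (2 * e + 2) (solve (e ∷ f ∷ [])) (solve (e ∷ f ∷ []))))
  (solve (e ∷ f ∷ []))

balanced-1⇒ : ∀ {k′ b₁ b₂ s₂} → b₁ < suc (suc k′ + suc k′) → b₂ < suc (suc k′ + suc k′) → s₂ < suc (suc k′ + suc k′) →
              Balanced (suc k′) b₁ 1 b₂ s₂ → s₂ ≡ k′ + suc k′ × ((b₁ ≡ k′ × b₂ ≡ 1) ⊎ (b₁ ≡ suc k′ × b₂ ≡ 0))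
balanced-1⇒ {k′} {b₁} {b₂} {s₂} b₁<n b₂<n s₂<n bal =
  row-0≡⇒step≡ n b₂<n s₂<n row₂ , bases b₂ (+-cancelʳ-< c b₂ 2 (subst (_< n) row₂ (m%n<n (b₂ + 1 * s₂) n))) b₁+b₂≡k
  where
  n c : ℕ
  n = suc (suc k′ + suc k′)
  c = k′ + suc k′
  b₁+b₂≡k : b₁ + b₂ ≡ suc k′
  b₁+b₂≡k = balanced⇒b₁+b₂≡k b₁<n b₂<n bal
  b₁≤c : b₁ ≤ c
  b₁≤c = ≤-trans (subst (b₁ ≤_) b₁+b₂≡k (m≤m+n b₁ b₂)) (m≤n+m (suc k′) k′)
  row₁ : row n b₁ 1 0 ≡ b₁ + 1
  row₁ = m<n⇒m%n≡m (s≤s (subst (_≤ suc c) (+-comm 1 b₁) (s≤s b₁≤c)))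
  row₂ : row n b₂ s₂ 0 ≡ b₂ + c
  row₂ = +-cancelˡ-≡ (b₁ + 1) _ _ (begin
    b₁ + 1 + row n b₂ s₂ 0        ≡⟨ cong (_+ row n b₂ s₂ 0) row₁ ⟨
    row n b₁ 1 0 + row n b₂ s₂ 0  ≡⟨ bal 0 z<s ⟩
    suc k′ + suc k′ + suc k′          ≡⟨ solve (k′ ∷ []) ⟩
    suc k′ + suc (k′ + suc k′)        ≡⟨ cong (_+ suc (k′ + suc k′)) b₁+b₂≡k ⟨
    b₁ + b₂ + suc (k′ + suc k′)       ≡⟨ solve (b₁ ∷ b₂ ∷ k′ ∷ []) ⟩
    b₁ + 1 + (b₂ + (k′ + suc k′))     ∎)
    where open ≡-Reasoning
  bases : ∀ {b₁ k} b₂ → b₂ < 2 → b₁ + b₂ ≡ suc k → (b₁ ≡ k × b₂ ≡ 1) ⊎ (b₁ ≡ suc k × b₂ ≡ 0)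
  bases 0 _ b₁+0≡k = inj₂ (trans (sym (+-identityʳ _)) b₁+0≡k , refl)
  bases 1 _ b₁+1≡k = inj₁ (suc-injective (trans (+-comm 1 _) b₁+1≡k) , refl)
  bases (suc (suc _)) (s≤s (s≤s ()))

balanced-k⇒s₂≡k : ∀ {b₁ b₂ s₂} → let k = b₁ + b₂ in b₂ < suc (k + k) → s₂ < suc (k + k) →
                   Balanced k b₁ k b₂ s₂ → s₂ ≡ k
balanced-k⇒s₂≡k {b₁} {b₂} {s₂} b₂<n s₂<n bal = row-0≡⇒step≡ (suc (k + k)) b₂<n s₂<n row₂
  where
  k : ℕ
  k = b₁ + b₂
  row₁ : row (suc (k + k)) b₁ k 0 ≡ b₁ + k
  row₁ = row≡ (b₁ + b₂) b₁ (b₁ + b₂) 0 (b₁ + (b₁ + b₂)) 0 b₂ (solve (b₁ ∷ b₂ ∷ [])) (solve (b₁ ∷ b₂ ∷ []))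
  row₂ : row (suc (k + k)) b₂ s₂ 0 ≡ b₂ + k
  row₂ = +-cancelˡ-≡ (b₁ + k) _ _ (begin
    b₁ + k + row (suc (k + k)) b₂ s₂ 0                    ≡⟨ cong (_+ row (suc (k + k)) b₂ s₂ 0) row₁ ⟨
    row (suc (k + k)) b₁ k 0 + row (suc (k + k)) b₂ s₂ 0  ≡⟨ bal 0 z<s ⟩
    (b₁ + b₂) + (b₁ + b₂) + (b₁ + b₂)                     ≡⟨ solve (b₁ ∷ b₂ ∷ []) ⟩
    b₁ + (b₁ + b₂) + (b₂ + (b₁ + b₂))                     ∎)
    where open ≡-Reasoning

-- If both bases are positive, the residues in column 1 are b₁ - 1 and b₂ - 1, so its level is k - 1.
balanced-k,k⇒base≡0 : ∀ b₁ b₂ → let k = b₁ + b₂ in Balanced k b₁ k b₂ k → (b₁ ≡ 0 × b₂ ≡ k) ⊎ (b₁ ≡ k × b₂ ≡ 0)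
balanced-k,k⇒base≡0 zero    b₂      _   = inj₁ (refl , refl)
balanced-k,k⇒base≡0 (suc u) zero    _   = inj₂ (sym (+-identityʳ _) , refl)
balanced-k,k⇒base≡0 (suc u) (suc v) bal = contradiction (trans excess (sym column₁)) (m+1+n≢m (1 + u + v))
  where
  k : ℕ
  k = suc u + suc v
  column₁ : 1 + u + v ≡ k + k + k
  column₁ = trans (cong₂ (λ x y → 1 + x + y)
      (sym (row≡ (suc u + suc v) (suc u) (suc u + suc v) 1 u 1 (u + 2 * v + 4) (solve (u ∷ v ∷ [])) (solve (u ∷ v ∷ []))))
      (sym (row≡ (suc u + suc v) (suc v) (suc u + suc v) 1 v 1 (2 * u + v + 4) (solve (u ∷ v ∷ [])) (solve (u ∷ v ∷ [])))))
    (bal 1 (s≤s (s≤s z≤n)))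
  excess : 1 + u + v + suc (2 * u + 2 * v + 4) ≡ (suc u + suc v) + (suc u + suc v) + (suc u + suc v)
  excess = solve (u ∷ v ∷ [])

balanced-k⇒ : ∀ {k b₁ b₂ s₂} → b₁ < suc (k + k) → b₂ < suc (k + k) → s₂ < suc (k + k) →
              Balanced k b₁ k b₂ s₂ → s₂ ≡ k × ((b₁ ≡ 0 × b₂ ≡ k) ⊎ (b₁ ≡ k × b₂ ≡ 0))
balanced-k⇒ {k} {b₁} {b₂} b₁<n b₂<n s₂<n bal with balanced⇒b₁+b₂≡k {k} b₁<n b₂<n bal
... | refl with balanced-k⇒s₂≡k {b₁} b₂<n s₂<n bal
...   | refl = refl , balanced-k,k⇒base≡0 b₁ b₂ bal

balanced-1⇔ : ∀ {k′ b₁ b₂ s₂} → b₁ < suc (suc k′ + suc k′) → b₂ < suc (suc k′ + suc k′) → s₂ < suc (suc k′ + suc k′) →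
              Balanced (suc k′) b₁ 1 b₂ s₂ ⇔ (s₂ ≡ k′ + suc k′ × ((b₁ ≡ k′ × b₂ ≡ 1) ⊎ (b₁ ≡ suc k′ × b₂ ≡ 0)))
balanced-1⇔ {k′} b₁<n b₂<n s₂<n = mk⇔ (balanced-1⇒ b₁<n b₂<n s₂<n) λ where
  (refl , inj₁ (refl , refl)) → balanced-k∸1,1,1,2k∸1 k′
  (refl , inj₂ (refl , refl)) → balanced-k,1,0,2k∸1 k′

balanced-k⇔ : ∀ {k b₁ b₂ s₂} → b₁ < suc (k + k) → b₂ < suc (k + k) → s₂ < suc (k + k) →
              Balanced k b₁ k b₂ s₂ ⇔ (s₂ ≡ k × ((b₁ ≡ 0 × b₂ ≡ k) ⊎ (b₁ ≡ k × b₂ ≡ 0)))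
balanced-k⇔ {k} b₁<n b₂<n s₂<n = mk⇔ (balanced-k⇒ b₁<n b₂<n s₂<n) λ where
  (refl , inj₁ (refl , refl)) → balanced-swap {k} {k} {k} {0} {k} (balanced-k,k,0,k k)
  (refl , inj₂ (refl , refl)) → balanced-k,k,0,k k

witness-steps : ℕ → Fin 3 → ℕ
witness-steps k zero    = 1
witness-steps k (suc _) = k

witness-base : ∀ k → Fin 3 → Fin (suc (k + k))
witness-base k zero             = fromℕ (k + k)
witness-base k (suc zero)       = fromℕ< (s≤s (m≤m+n k k))
witness-base k (suc (suc zero)) = zero

witness : ∀ k → Tuple 4 (suc (k + k))
witness k = gen 4 (suc (k + k)) (witness-steps k) (witness-base k)

witness∈S : ∀ k → InS 4 (suc (k + k)) (witness k)
witness∈S k = gen∈S 4 _ (witness-steps k) (witness-base k) n⊥steps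
  where
  k+[k+1]≡n : k + (k + 1) ≡ suc (k + k)
  k+[k+1]≡n = solve (k ∷ [])
  n⊥steps : ∀ r → Coprime (suc (k + k)) (witness-steps k r)
  n⊥steps zero    = Coprime.sym (1-coprimeTo _)
  n⊥steps (suc _) = subst (λ n → Coprime n k) k+[k+1]≡n (coprime-+ (coprime-+ (1-coprimeTo k)))

witness-flat : ∀ k → Flat 4 (suc (k + k)) (witness k) (k + k + k)
witness-flat k = Equivalence.from (flat⇔balanced k (witness-steps k) (witness-base k) refl (toℕ-fromℕ (k + k)))
  (subst (λ b₁ → Balanced k b₁ k 0 k) (sym (toℕ-fromℕ< (s≤s (m≤m+n k k)))) (balanced-k,k,0,k k))

minimal⇔balanced : ∀ k (s : Fin 3 → ℕ) (base : Fin 3 → Fin (suc (k + k))) →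
  (∀ r → Coprime (suc (k + k)) (s r)) → s zero ≡ 1 → toℕ (base zero) ≡ k + k →
  InM 4 (suc (k + k)) (gen 4 (suc (k + k)) s base) ⇔
    Balanced k (toℕ (base (suc zero))) (s (suc zero)) (toℕ (base (suc (suc zero)))) (s (suc (suc zero)))
minimal⇔balanced k s base n⊥s s₀≡1 b₀≡2k = ⇔.trans
  (minimal⇔flat {4} {suc (k + k)} (witness∈S k) (witness-flat k) (gen 4 _ s base) (gen∈S 4 _ s base n⊥s))
  (flat⇔balanced k s base s₀≡1 b₀≡2k)

classification : ∀ {n} k .{{_ : NonZero n}} → n ≡ suc (k + k) → 1 ≤ k →
  (s : Fin 3 → ℕ) → (base : Fin 3 → Fin n) →
  (∀ r → s r ≤ n ∸ 1) → (∀ r → gcd (s r) n ≡ 1) →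
  s zero ≡ 1 → toℕ (base zero) ≡ n ∸ 1 →
  (s (suc zero) ≡ 1 →
    (InM 4 n (gen 4 n s base) ⇔
      (s (suc (suc zero)) ≡ n ∸ 2 ×
        ((toℕ (base (suc zero)) ≡ k ∸ 1 × toℕ (base (suc (suc zero))) ≡ 1)
         ⊎ (toℕ (base (suc zero)) ≡ k × toℕ (base (suc (suc zero))) ≡ 0)))))
  ×
  (s (suc zero) ≡ k →
    (InM 4 n (gen 4 n s base) ⇔
      (s (suc (suc zero)) ≡ k ×
        ((toℕ (base (suc zero)) ≡ 0 × toℕ (base (suc (suc zero))) ≡ k)
         ⊎ (toℕ (base (suc zero)) ≡ k × toℕ (base (suc (suc zero))) ≡ 0)))))
classification (suc k′) refl (s≤s z≤n) s base s≤2k gcd≡1 s₀≡1 b₀≡2k =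
  (λ s₁≡1 → ⇔.trans minimal⇔bal (⇔.trans (step₁-cong s₁≡1) (balanced-1⇔ b₁<n b₂<n s₂<n))) ,
  (λ s₁≡k → ⇔.trans minimal⇔bal (⇔.trans (step₁-cong s₁≡k) (balanced-k⇔ b₁<n b₂<n s₂<n)))
  where
  k b₁ b₂ s₂ : ℕ
  k = suc k′
  b₁ = toℕ (base (suc zero))
  b₂ = toℕ (base (suc (suc zero)))
  s₂ = s (suc (suc zero))
  b₁<n : b₁ < suc (k + k)
  b₁<n = toℕ<n (base (suc zero))
  b₂<n : b₂ < suc (k + k)
  b₂<n = toℕ<n (base (suc (suc zero)))
  s₂<n : s₂ < suc (k + k)
  s₂<n = s≤s (s≤2k (suc (suc zero)))
  step₁-cong : ∀ {t} → s (suc zero) ≡ t → Balanced k b₁ (s (suc zero)) b₂ s₂ ⇔ Balanced k b₁ t b₂ s₂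
  step₁-cong refl = ⇔.refl
  minimal⇔bal : InM 4 (suc (k + k)) (gen 4 (suc (k + k)) s base) ⇔ Balanced k b₁ (s (suc zero)) b₂ s₂
  minimal⇔bal = minimal⇔balanced k s base (λ r → Coprime.sym (gcd≡1⇒coprime (gcd≡1 r))) s₀≡1 b₀≡2k

theorem4p4 :
    (∀ (n d : ℕ) .{{_ : NonZero n}} → 2 ≤ d → (n % 2 ≡ 1 ⊎ d % 2 ≡ 1) →
      (s : Fin (d ∸ 1) → ℕ) → (base : Fin (d ∸ 1) → Fin n) →
      (∀ r → 1 ≤ s r × s r ≤ n ∸ 1) → (∀ r → gcd (s r) n ≡ 1) →
      InS d n (gen d n s base))
    ×
    (∀ (n k : ℕ) .{{_ : NonZero n}} → 1 ≤ k → n ≡ 2 * k + 1 →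
      (s : Fin 3 → ℕ) → (base : Fin 3 → Fin n) →
      (∀ r → 1 ≤ s r × s r ≤ n ∸ 1) → (∀ r → gcd (s r) n ≡ 1) →
      s zero ≡ 1 → toℕ (base zero) ≡ n ∸ 1 →
      (s (suc zero) ≡ 1 →
        (InM 4 n (gen 4 n s base) ⇔
          (s (suc (suc zero)) ≡ n ∸ 2 ×
            ((toℕ (base (suc zero)) ≡ k ∸ 1 × toℕ (base (suc (suc zero))) ≡ 1)
             ⊎ (toℕ (base (suc zero)) ≡ k × toℕ (base (suc (suc zero))) ≡ 0)))))
      ×
      (s (suc zero) ≡ k →
        (InM 4 n (gen 4 n s base) ⇔
          (s (suc (suc zero)) ≡ k ×
            ((toℕ (base (suc zero)) ≡ 0 × toℕ (base (suc (suc zero))) ≡ k)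
             ⊎ (toℕ (base (suc zero)) ≡ k × toℕ (base (suc (suc zero))) ≡ 0))))))
theorem4p4 =
  (λ n d _ _ s base _ gcd≡1 → gen∈S d n s base (Coprime.sym ∘ gcd≡1⇒coprime ∘ gcd≡1)) ,
  (λ n k 1≤k n≡2k+1 s base bounds →
     classification k (trans n≡2k+1 (2k+1≡1+k+k k)) 1≤k s base (proj₂ ∘ bounds))
  where
  2k+1≡1+k+k : ∀ k → 2 * k + 1 ≡ suc (k + k)
  2k+1≡1+k+k = solve-∀
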